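{- The relation $\sqsupseteq$ is monotonic: for all terms $s, s' :: \sigma \Rightarrow \tau$ and $t, t' :: \sigma$, if $s \sqsupseteq s'$ and $t \sqsupseteq t'$ then $s\ t \sqsupseteq s'\ t'$.
   Context: Simply typed terms: there is a single base type (sort) $\iota$; types are $\iota$ and $\sigma \Rightarrow \tau$. Given a set of typed variables (infinitely many of each type) and a possibly infinite set of typed function symbols, terms are built from variables and function symbols by type-respecting application: if $s :: \sigma \Rightarrow \tau$ and $t :: \sigma$ then $s\ t :: \tau$ (left-associative). Every term has the form $a\ s_1 \cdots s_n$ ($n\ge 0$) with $a$ a variable or function symbol. Fixed data: a precedence $\unrhd$ (a quasi-ordering on function symbols whose strict part $\rhd$ is well-founded; $\equiv$ denotes $\unrhd \cap \unlhd$), and a filter $\pi$ assigning to each $\mathsf{f} :: \sigma_1 \Rightarrow \dots \Rightarrow \sigma_m \Rightarrow \iota$ a set $\pi(\mathsf{f}) \subseteq \{1,\dots,m\}$; for each $\mathsf{f}$ the arities of the symbols $\mathsf{g} \equiv \mathsf{f}$ are bounded. Equivalence: $s \approx t$ iff $s,t$ have the same type and either (Eq-mono) $s = x\ s_1 \cdots s_n$, $t = x\ t_1 \cdots t_n$, $x$ a variable, $s_i \approx t_i$ for all $i$; or (Eq-args) $s = \mathsf{f}\ s_1 \cdots s_n$, $t = \mathsf{g}\ t_1 \cdots t_n$, $\mathsf{f},\mathsf{g}$ function symbols of the same type, $\mathsf{f} \equiv \mathsf{g}$, $\pi(\mathsf{f}) = \pi(\mathsf{g})$, $s_i \approx t_i$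 for all $i \in \pi(\mathsf{f}) \cap \{1,\dots,n\}$. The relations $\sqsupseteq, \sqsupset, \sqsupset\!\!\sqsupset$ are the least relations such that: $s \sqsupseteq t$ iff $s \approx t$ or $s \sqsupset t$. $s \sqsupset t$ if $s,t$ have the same type and one of: (Gr-mono) $s = x\ s_1 \cdots s_n$, $t = x\ t_1 \cdots t_n$, $x$ a variable, $s_i \sqsupseteq t_i$ for all $i$ and $s_i \sqsupset t_i$ for some $i$; (Gr-args) $s = \mathsf{f}\ s_1 \cdots s_n$, $t = \mathsf{g}\ t_1 \cdots t_n$, $\mathsf{f},\mathsf{g}$ of the same type, $\mathsf{f} \equiv \mathsf{g}$, $\pi(\mathsf{f}) = \pi(\mathsf{g})$, $s_i \sqsupseteq t_i$ for all $i \in \pi(\mathsf{f}) \cap \{1,\dots,n\}$ and $s_i \sqsupset t_i$ for some such $i$; (Gr-rpo) $s \sqsupset\!\!\sqsupset t$. $s \sqsupset\!\!\sqsupset t$ ($s,t$ possibly of different types) if $s = \mathsf{f}\ s_1 \cdots s_n$ with $\mathsf{f} :: \sigma_1 \Rightarrow \dots \Rightarrow \sigma_m \Rightarrow \iota$, $\{n+1,\dots,m\} \subseteq \pi(\mathsf{f})$, and one of: (Rpo-select) $s_i \sqsupseteq t$ for some $i \in \pi(\mathsf{f}) \cap \{1,\dots,n\}$; (Rpo-appl) $t = t_0\ t_1 \cdots t_k$ with $k \ge 1$ and $s \sqsupset\!\!\sqsupset t_i$ for all $0 \le i \le k$; (Rpo-copy) $t = \mathsf{g}\ t_1 \cdots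 t_k$ with $\mathsf{f} \rhd \mathsf{g}$ and $s \sqsupset\!\!\sqsupset t_i$ for all $i \in \pi(\mathsf{g}) \cap \{1,\dots,k\}$; (Rpo-lex) $t = \mathsf{g}\ t_1 \cdots t_k$ with $\mathsf{f} \equiv \mathsf{g}$ and there is $i \in \pi(\mathsf{f}) \cap \pi(\mathsf{g}) \cap \{1,\dots,\min(n,k)\}$ with $\pi(\mathsf{f}) \cap \{1,\dots,i\} = \pi(\mathsf{g}) \cap \{1,\dots,i\}$, $s_j \approx t_j$ for all $j \in \{1,\dots,i-1\} \cap \pi(\mathsf{f})$, $s_i \sqsupset t_i$, and $s \sqsupset\!\!\sqsupset t_j$ for all $j \in \{i+1,\dots,k\} \cap \pi(\mathsf{g})$. -}

module Defs where

open import Data.Nat using (ℕ; zero; suc; _≤_; _<_)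
open import Data.Bool using (Bool; true; false)
open import Data.Product using (_×_; ∃)
open import Relation.Nullary using (¬_)
open import Relation.Binary.PropositionalEquality using (_≡_)
open import Induction.WellFounded using (WellFounded)

infixr 5 _⇒_
data Ty : Set where
  ι   : Ty
  _⇒_ : Ty → Ty → Ty

arity : Ty → ℕ
arity ι       = 0
arity (_ ⇒ τ) = suc (arity τ)

record Setting : Set₁ where
  field
    Sym  : Set
    type : Sym → Ty
    _⊵_  : Sym → Sym → Set
    ⊵-refl  : ∀ f → f ⊵ f
    ⊵-trans : ∀ {f g h} → f ⊵ g → g ⊵ h → f ⊵ h
    π    : Sym → ℕ → Bool      -- filter: i ∈ π(f) iff π f i ≡ true
  _▷_ : Sym → Sym → Set
  f ▷ g = f ⊵ g × ¬ (g ⊵ f)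
  _≃_ : Sym → Sym → Set
  f ≃ g = f ⊵ g × g ⊵ f
  _◁_ : Sym → Sym → Set
  g ◁ f = f ▷ g
  field
    ▷-wf     : WellFounded _◁_
    π-bound  : ∀ f i → π f i ≡ true → 1 ≤ i × i ≤ arity (type f)
    ≃-arity  : ∀ f → ∃ λ B → ∀ g → g ≃ f → arity (type g) ≤ B

-- Terms, in head–spine form  a s₁ ⋯ sₙ  (intrinsically typed).
-- Variables: for each type σ, the variables of type σ are indexed by ℕ.

module _ (S : Setting) where
  open Setting S

  data Head : Ty → Set where
    var : ∀ {σ} → ℕ → Head σ
    fun : (f : Sym) → Head (type f)

  infixr 5 _∷_
  infix  4 _·_

  mutual
    data Spine : Ty → Ty → Set where
      []  : ∀ {σ} → Spine σ σ
      _∷_ : ∀ {σ τ ρ} → Tm σ → Spine τ ρ → Spine (σ ⇒ τ) ρ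

    data Tm : Ty → Set where
      _·_ : ∀ {σ τ} → Head σ → Spine σ τ → Tm τ

module _ {S : Setting} where

  _++_ : ∀ {σ τ ρ} → Spine S σ τ → Spine S τ ρ → Spine S σ ρ
  []       ++ ts = ts
  (s ∷ ss) ++ ts = s ∷ (ss ++ ts)

  app : ∀ {σ τ} → Tm S (σ ⇒ τ) → Tm S σ → Tm S τ
  app (h · ss) t = h · (ss ++ (t ∷ []))

  length : ∀ {σ τ} → Spine S σ τ → ℕ
  length []       = 0
  length (_ ∷ ss) = suc (length ss)

-- Generic positional predicates on spines (positions counted from the
-- given index, which is 1 for the first argument).

module _ {S : Setting} where

  HRel : Set₁
  HRel = ∀ {a b} → Tm S a → Tm S b → Set

  data AllF (R : HRel) (P : ℕ → Bool) : ∀ {σ τ σ' τ'} → ℕ →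
            Spine S σ τ → Spine S σ' τ' → Set where
    []  : ∀ {σ σ' i} → AllF R P {σ} {σ} {σ'} {σ'} i [] []
    _∷_ : ∀ {σ τ ρ σ' τ' ρ' i} {s : Tm S σ} {t : Tm S σ'}
            {ss : Spine S τ ρ} {ts : Spine S τ' ρ'} →
          (P i ≡ true → R s t) → AllF R P (suc i) ss ts →
          AllF R P i (s ∷ ss) (t ∷ ts)

  data AnyF (R : HRel) (P : ℕ → Bool) : ∀ {σ τ σ' τ'} → ℕ →
            Spine S σ τ → Spine S σ' τ' → Set where
    here  : ∀ {σ τ ρ σ' τ' ρ' i} {s : Tm S σ} {t : Tm S σ'}
              {ss : Spine S τ ρ} {ts : Spine S τ' ρ'} →
            P i ≡ true → R s t → AnyF R P i (s ∷ ss) (t ∷ ts)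
    there : ∀ {σ τ ρ σ' τ' ρ' i} {s : Tm S σ} {t : Tm S σ'}
              {ss : Spine S τ ρ} {ts : Spine S τ' ρ'} →
            AnyF R P (suc i) ss ts → AnyF R P i (s ∷ ss) (t ∷ ts)

  URel : Set₁
  URel = ∀ {a} → Tm S a → Set

  data AllU (Q : URel) (P : ℕ → Bool) : ∀ {σ τ} → ℕ → Spine S σ τ → Set where
    []  : ∀ {σ i} → AllU Q P {σ} {σ} i []
    _∷_ : ∀ {σ τ ρ i} {t : Tm S σ} {ts : Spine S τ ρ} →
          (P i ≡ true → Q t) → AllU Q P (suc i) ts → AllU Q P i (t ∷ ts)

  data AnyU (Q : URel) (P : ℕ → Bool) : ∀ {σ τ} → ℕ → Spine S σ τ → Set where
    here  : ∀ {σ τ ρ i} {t : Tm S σ} {ts : Spine S τ ρ} →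
            P i ≡ true → Q t → AnyU Q P i (t ∷ ts)
    there : ∀ {σ τ ρ i} {t : Tm S σ} {ts : Spine S τ ρ} →
            AnyU Q P (suc i) ts → AnyU Q P i (t ∷ ts)

  -- The lexicographic condition of (Rpo-lex), for filters P = π(f),
  -- Q = π(g), relations E = ≈, G = ⊐ and U = (s ⊐⊐ _):
  -- there is a position i (within both spines) with i ∈ P ∩ Q,
  -- P ∩ {1..i} = Q ∩ {1..i}, E sⱼ tⱼ for j < i with j ∈ P, G sᵢ tᵢ,
  -- and U tⱼ for all j > i with j ∈ Q.
  data Lex (E G : HRel) (U : URel) (P Q : ℕ → Bool) : ∀ {σ τ σ' τ'} → ℕ →
           Spine S σ τ → Spine S σ' τ' → Set where
    lex-eq   : ∀ {σ τ ρ σ' τ' ρ' i} {s : Tm S σ} {t : Tm S σ'}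
                 {ss : Spine S τ ρ} {ts : Spine S τ' ρ'} →
               P i ≡ Q i → (P i ≡ true → E s t) → Lex E G U P Q (suc i) ss ts →
               Lex E G U P Q i (s ∷ ss) (t ∷ ts)
    lex-here : ∀ {σ τ ρ σ' τ' ρ' i} {s : Tm S σ} {t : Tm S σ'}
                 {ss : Spine S τ ρ} {ts : Spine S τ' ρ'} →
               P i ≡ true → Q i ≡ true → G s t → AllU U Q (suc i) ts →
               Lex E G U P Q i (s ∷ ss) (t ∷ ts)

-- They are stated heterogeneously in the types; the constructors of
-- ≈, ⊒, ⊐ only relate terms of the same type, ⊐⊐ may relate terms of
-- different types.

module _ {S : Setting} where
  open Setting S

  all : ℕ → Bool
  all _ = true

  TailFiltered : Sym → ℕ → Set
  TailFiltered f n = ∀ j → n < j → j ≤ arity (type f) → π f j ≡ true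

  SameFilter : Sym → Sym → Set
  SameFilter f g = ∀ i → π f i ≡ π g i

  infix 4 _≈_ _⊒_ _⊐_ _⊐⊐_

  data _≈_ : HRel {S}
  data _⊒_ : HRel {S}
  data _⊐_ : HRel {S}
  data _⊐⊐_ : HRel {S}

  data _≈_ where
    eq-mono : ∀ {σ τ} {x : ℕ} {ss ts : Spine S σ τ} →
              AllF _≈_ all 1 ss ts →
              (var x · ss) ≈ (var x · ts)
    eq-args : ∀ {τ} {f g : Sym} {ss : Spine S (type f) τ} {ts : Spine S (type g) τ} →
              type f ≡ type g → f ≃ g → SameFilter f g →
              AllF _≈_ (π f) 1 ss ts →
              (fun f · ss) ≈ (fun g · ts)

  data _⊒_ where
    ⊒-≈ : ∀ {a} {s t : Tm S a} → s ≈ t → s ⊒ t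
    ⊒-⊐ : ∀ {a} {s t : Tm S a} → s ⊐ t → s ⊒ t

  data _⊐_ where
    gr-mono : ∀ {σ τ} {x : ℕ} {ss ts : Spine S σ τ} →
              AllF _⊒_ all 1 ss ts → AnyF _⊐_ all 1 ss ts →
              (var x · ss) ⊐ (var x · ts)
    gr-args : ∀ {τ} {f g : Sym} {ss : Spine S (type f) τ} {ts : Spine S (type g) τ} →
              type f ≡ type g → f ≃ g → SameFilter f g →
              AllF _⊒_ (π f) 1 ss ts → AnyF _⊐_ (π f) 1 ss ts →
              (fun f · ss) ⊐ (fun g · ts)
    gr-rpo  : ∀ {a} {s t : Tm S a} → s ⊐⊐ t → s ⊐ t

  data _⊐⊐_ where
    rpo-select : ∀ {τ b} {f : Sym} {ss : Spine S (type f) τ} {t : Tm S b} →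
                 TailFiltered f (length ss) →
                 AnyU (λ u → u ⊒ t) (π f) 1 ss →
                 (fun f · ss) ⊐⊐ t
    rpo-appl   : ∀ {τ ρ σ μ ν} {f : Sym} {ss : Spine S (type f) τ}
                   {h : Head S ρ} {ts₀ : Spine S ρ (σ ⇒ μ)}
                   {t₁ : Tm S σ} {ts : Spine S μ ν} →
                 TailFiltered f (length ss) →
                 (fun f · ss) ⊐⊐ (h · ts₀) →
                 AllU (λ u → (fun f · ss) ⊐⊐ u) all 1 (t₁ ∷ ts) →
                 (fun f · ss) ⊐⊐ (h · (ts₀ ++ (t₁ ∷ ts)))
    rpo-copy   : ∀ {τ ν} {f g : Sym} {ss : Spine S (type f) τ}
                   {ts : Spine S (type g) ν} →
                 TailFiltered f (length ss) →
                 f ▷ g →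
                 AllU (λ u → (fun f · ss) ⊐⊐ u) (π g) 1 ts →
                 (fun f · ss) ⊐⊐ (fun g · ts)
    rpo-lex    : ∀ {τ ν} {f g : Sym} {ss : Spine S (type f) τ}
                   {ts : Spine S (type g) ν} →
                 TailFiltered f (length ss) →
                 f ≃ g →
                 Lex _≈_ _⊐_ (λ u → (fun f · ss) ⊐⊐ u) (π f) (π g) 1 ss ts →
                 (fun f · ss) ⊐⊐ (fun g · ts)

{-# OPTIONS --safe #-}
module Submission where

open import Defs
open import Data.Nat using (ℕ; suc; _<_; _+_; s≤s; z≤n)
open import Data.Nat.Properties using (+-identityʳ; +-suc; ≤-refl; ≤-trans; n≤1+n)
open import Data.Bool using (Bool; true; false)
open import Relation.Nullary using (contradiction)
open import Relation.Binary.PropositionalEquality using (_≡_; refl; sym; trans; subst)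

-- Appending an argument keeps every positional condition at the old
-- positions, and the new position n+1 is settled by t ⊒ t'.  For
-- s = f s₁ ⋯ sₙ ⊐⊐ s' the side condition {n+1, …, m} ⊆ π(f) does the
-- work: it survives appending an argument, so s ⊐⊐ u implies s t ⊐⊐ u;
-- and it puts n+1 into π(f), so s t ⊐⊐ t' by (Rpo-select), whence
-- s t ⊐⊐ s' t' by (Rpo-appl).  If s ≈ s' and t ⊐ t', then s t ⊐ s' t'
-- when n+1 is an unfiltered position, and s t ≈ s' t' otherwise.

module _ {S : Setting} where
  open Setting S using (type; π)

  snoc : ∀ {σ τ ρ} → Spine S σ (τ ⇒ ρ) → Tm S τ → Spine S σ ρ
  snoc ss t = ss ++ (t ∷ [])

  nextPos : ∀ {σ τ} → ℕ → Spine S σ τ → ℕ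
  nextPos i []       = i
  nextPos i (_ ∷ ss) = nextPos (suc i) ss

  nextPos≡ : ∀ {σ τ} i (ss : Spine S σ τ) → nextPos i ss ≡ i + length ss
  nextPos≡ i []       = sym (+-identityʳ i)
  nextPos≡ i (_ ∷ ss) = trans (nextPos≡ (suc i) ss) (sym (+-suc i (length ss)))

  length-snoc : ∀ {σ τ ρ} (ss : Spine S σ (τ ⇒ ρ)) (t : Tm S τ) →
                length (snoc ss t) ≡ suc (length ss)
  length-snoc []       t = refl
  length-snoc (_ ∷ ss) t rewrite length-snoc ss t = refl

  length<arity : ∀ {σ τ ρ} (ss : Spine S σ (τ ⇒ ρ)) → length ss < arity σ
  length<arity []       = s≤s z≤n
  length<arity (_ ∷ ss) = s≤s (length<arity ss)

  AllF-map : ∀ {R R' : HRel {S}} {P σ τ σ' τ' i} {ss : Spine S σ τ} {ts : Spine S σ' τ'} →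
             (∀ {a b} {u : Tm S a} {v : Tm S b} → R u v → R' u v) →
             AllF R P i ss ts → AllF R' P i ss ts
  AllF-map f []       = []
  AllF-map f (r ∷ rs) = (λ p → f (r p)) ∷ AllF-map f rs

  AllF-snoc : ∀ {R : HRel {S}} {P σ τ ρ σ' τ' ρ' i}
                {ss : Spine S σ (τ ⇒ ρ)} {ts : Spine S σ' (τ' ⇒ ρ')} {s : Tm S τ} {t : Tm S τ'} →
              AllF R P i ss ts → (P (nextPos i ss) ≡ true → R s t) →
              AllF R P i (snoc ss s) (snoc ts t)
  AllF-snoc []       r = r ∷ []
  AllF-snoc (q ∷ rs) r = q ∷ AllF-snoc rs r

  AnyF-snoc⁺ˡ : ∀ {R : HRel {S}} {P σ τ ρ σ' τ' ρ' i}
                  {ss : Spine S σ (τ ⇒ ρ)} {ts : Spine S σ' (τ' ⇒ ρ')} {s : Tm S τ} {t : Tm S τ'} →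
                AnyF R P i ss ts → AnyF R P i (snoc ss s) (snoc ts t)
  AnyF-snoc⁺ˡ (here p r) = here p r
  AnyF-snoc⁺ˡ (there rs) = there (AnyF-snoc⁺ˡ rs)

  AnyF-snoc⁺ʳ : ∀ {R Q : HRel {S}} {P σ τ ρ σ' τ' ρ' i}
                  {ss : Spine S σ (τ ⇒ ρ)} {ts : Spine S σ' (τ' ⇒ ρ')} {s : Tm S τ} {t : Tm S τ'} →
                AllF Q P i ss ts → P (nextPos i ss) ≡ true → R s t →
                AnyF R P i (snoc ss s) (snoc ts t)
  AnyF-snoc⁺ʳ []       p r = here p r
  AnyF-snoc⁺ʳ (_ ∷ qs) p r = there (AnyF-snoc⁺ʳ qs p r)

  AnyU-snoc⁺ˡ : ∀ {Q : URel {S}} {P σ τ ρ i} {ss : Spine S σ (τ ⇒ ρ)} {t : Tm S τ} →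
                AnyU Q P i ss → AnyU Q P i (snoc ss t)
  AnyU-snoc⁺ˡ (here p q) = here p q
  AnyU-snoc⁺ˡ (there qs) = there (AnyU-snoc⁺ˡ qs)

  AnyU-snoc⁺ʳ : ∀ {Q : URel {S}} {P σ τ ρ i} (ss : Spine S σ (τ ⇒ ρ)) {t : Tm S τ} →
                P (nextPos i ss) ≡ true → Q t → AnyU Q P i (snoc ss t)
  AnyU-snoc⁺ʳ []       p q = here p q
  AnyU-snoc⁺ʳ (_ ∷ ss) p q = there (AnyU-snoc⁺ʳ ss p q)

  TailFiltered-snoc : ∀ {f τ ρ} {ss : Spine S (type f) (τ ⇒ ρ)} {t : Tm S τ} →
                      TailFiltered {S} f (length ss) → TailFiltered {S} f (length (snoc ss t))
  TailFiltered-snoc {ss = ss} {t} tf j n<j j≤m =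
    tf j (≤-trans (n≤1+n _) (subst (_< j) (length-snoc ss t) n<j)) j≤m

  TailFiltered⇒π-nextPos : ∀ {f τ ρ} (ss : Spine S (type f) (τ ⇒ ρ)) →
                           TailFiltered {S} f (length ss) → π f (nextPos 1 ss) ≡ true
  TailFiltered⇒π-nextPos ss tf rewrite nextPos≡ 1 ss = tf (suc (length ss)) ≤-refl (length<arity ss)

  -- ≈ is stated heterogeneously; matching on it makes the two types agree
  ≈⇒⊒ : ∀ {a b} {u : Tm S a} {v : Tm S b} → u ≈ v → u ⊒ v
  ≈⇒⊒ e@(eq-mono _)       = ⊒-≈ e
  ≈⇒⊒ e@(eq-args _ _ _ _) = ⊒-≈ e

  ≈-app : ∀ {σ τ} {s s' : Tm S (σ ⇒ τ)} {t t' : Tm S σ} → s ≈ s' → t ≈ t' → app s t ≈ app s' t'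
  ≈-app (eq-mono es)             e = eq-mono (AllF-snoc es (λ _ → e))
  ≈-app (eq-args ty f≃g sf es) e = eq-args ty f≃g sf (AllF-snoc es (λ _ → e))

  mutual
    ⊐⊐-app : ∀ {σ τ b} {s : Tm S (σ ⇒ τ)} {u : Tm S b} (t : Tm S σ) → s ⊐⊐ u → app s t ⊐⊐ u
    ⊐⊐-app t (rpo-select tf us)   = rpo-select (TailFiltered-snoc tf) (AnyU-snoc⁺ˡ us)
    ⊐⊐-app t (rpo-appl tf r us)   = rpo-appl (TailFiltered-snoc tf) (⊐⊐-app t r) (AllU-⊐⊐-app t us)
    ⊐⊐-app t (rpo-copy tf f▷g us) = rpo-copy (TailFiltered-snoc tf) f▷g (AllU-⊐⊐-app t us)
    ⊐⊐-app t (rpo-lex tf f≃g l)   = rpo-lex (TailFiltered-snoc tf) f≃g (Lex-⊐⊐-app t l)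

    AllU-⊐⊐-app : ∀ {σ τ ρ ν i} {P : ℕ → Bool} {s : Tm S (σ ⇒ τ)} {ts : Spine S ρ ν} (t : Tm S σ) →
                  AllU (s ⊐⊐_) P i ts → AllU (app s t ⊐⊐_) P i ts
    AllU-⊐⊐-app t []       = []
    AllU-⊐⊐-app t (r ∷ rs) = (λ p → ⊐⊐-app t (r p)) ∷ AllU-⊐⊐-app t rs

    Lex-⊐⊐-app : ∀ {f σ τ ρ ρ' ν ν' i} {P Q : ℕ → Bool}
                   {ss : Spine S (type f) (σ ⇒ τ)} {ss' : Spine S ρ (σ ⇒ ν')} {ts : Spine S ρ' ν}
                   (t : Tm S σ) →
                 Lex _≈_ _⊐_ ((fun f · ss) ⊐⊐_) P Q i ss' ts →
                 Lex _≈_ _⊐_ ((fun f · snoc ss t) ⊐⊐_) P Q i (snoc ss' t) ts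
    Lex-⊐⊐-app t (lex-eq p e l) = lex-eq p e (Lex-⊐⊐-app t l)
    Lex-⊐⊐-app {f} {ss = ss} t (lex-here p q g us) = lex-here p q g (AllU-⊐⊐-app {s = fun f · ss} t us)

  rpo-tailFiltered : ∀ {f τ b} {ss : Spine S (type f) τ} {u : Tm S b} →
                     (fun f · ss) ⊐⊐ u → TailFiltered {S} f (length ss)
  rpo-tailFiltered (rpo-select tf _) = tf
  rpo-tailFiltered (rpo-appl tf _ _) = tf
  rpo-tailFiltered (rpo-copy tf _ _) = tf
  rpo-tailFiltered (rpo-lex tf _ _)  = tf

  ⊐⊐-app-mono : ∀ {σ τ} {s s' : Tm S (σ ⇒ τ)} {t t' : Tm S σ} →
                s ⊐⊐ s' → t ⊒ t' → app s t ⊐⊐ app s' t'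
  ⊐⊐-app-mono {s = var _ · _} ()
  ⊐⊐-app-mono {s = fun f · ss} {s' = _ · _} {t} {t'} r t⊒t' =
    rpo-appl tf⁺ (⊐⊐-app t r) ((λ _ → st⊐⊐t') ∷ [])
    where
      tf : TailFiltered {S} f (length ss)
      tf = rpo-tailFiltered r

      tf⁺ : TailFiltered {S} f (length (snoc ss t))
      tf⁺ = TailFiltered-snoc tf

      st⊐⊐t' : (fun f · snoc ss t) ⊐⊐ t'
      st⊐⊐t' = rpo-select tf⁺ (AnyU-snoc⁺ʳ ss (TailFiltered⇒π-nextPos ss tf) t⊒t')

  ⊐-app : ∀ {σ τ} {s s' : Tm S (σ ⇒ τ)} {t t' : Tm S σ} → s ⊐ s' → t ⊒ t' → app s t ⊐ app s' t'
  ⊐-app (gr-mono gs g)           t⊒t' = gr-mono (AllF-snoc gs (λ _ → t⊒t')) (AnyF-snoc⁺ˡ g)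
  ⊐-app (gr-args ty f≃g sf gs g) t⊒t' = gr-args ty f≃g sf (AllF-snoc gs (λ _ → t⊒t')) (AnyF-snoc⁺ˡ g)
  ⊐-app (gr-rpo r)               t⊒t' = gr-rpo (⊐⊐-app-mono r t⊒t')

  ≈-⊐-app : ∀ {σ τ} {s s' : Tm S (σ ⇒ τ)} {t t' : Tm S σ} → s ≈ s' → t ⊐ t' → app s t ⊒ app s' t'
  ≈-⊐-app (eq-mono es) g = ⊒-⊐ (gr-mono (AllF-snoc (AllF-map ≈⇒⊒ es) (λ _ → ⊒-⊐ g)) (AnyF-snoc⁺ʳ es refl g))
  ≈-⊐-app {s = fun f · ss} (eq-args ty f≃g sf es) g with π f (nextPos 1 ss) in eq
  ... | true  = ⊒-⊐ (gr-args ty f≃g sf (AllF-snoc (AllF-map ≈⇒⊒ es) (λ _ → ⊒-⊐ g)) (AnyF-snoc⁺ʳ es eq g))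
  ... | false = ⊒-≈ (eq-args ty f≃g sf (AllF-snoc es (λ p → contradiction (trans (sym eq) p) λ ())))

  ⊒-app : ∀ {σ τ} {s s' : Tm S (σ ⇒ τ)} {t t' : Tm S σ} → s ⊒ s' → t ⊒ t' → app s t ⊒ app s' t'
  ⊒-app (⊒-≈ e) (⊒-≈ e') = ⊒-≈ (≈-app e e')
  ⊒-app (⊒-≈ e) (⊒-⊐ g)  = ≈-⊐-app e g
  ⊒-app (⊒-⊐ g) t⊒t'     = ⊒-⊐ (⊐-app g t⊒t')

lemma7 : (S : Setting) → ∀ {σ τ} (s s' : Tm S (σ ⇒ τ)) (t t' : Tm S σ) →
    s ⊒ s' → t ⊒ t' → app s t ⊒ app s' t'
lemma7 S s s' t t' = ⊒-app
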